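{- Let $\mathcal{V}$ be a finite ground set, $1\le\tau\le k$ integers, and $h:\mathcal{H}(\mathcal{V})\to\mathbb{R}_{\ge0}$ with $h(())=0$ forward-monotone. Then for every $\mathcal{V}'\subseteq\mathcal{V}$ with $|\mathcal{V}'|\le\tau$, $$\max_{S\in\mathcal{H}(\mathcal{V}),|S|\le k}\ \min_{\mathcal{W}\subseteq\mathcal{V}(S),|\mathcal{W}|\le\tau}h(S-\mathcal{W})\ \le\ \max_{S\in\mathcal{H}(\mathcal{V}\setminus\mathcal{V}'),|S|\le k-\tau}h(S).$$
   Context: $\mathcal{H}(\mathcal{W}_0)$ denotes the set of all finite sequences of pairwise distinct elements of a set $\mathcal{W}_0$, including the empty sequence $()$. For a sequence $S$, $\mathcal{V}(S)$ is its set of elements and $|S|=|\mathcal{V}(S)|$. For a set $\mathcal{U}$, $S-\mathcal{U}$ is obtained from $S$ by deleting the elements of $\mathcal{U}$ keeping the order of the remaining elements. For $S_1=(v_1,\dots,v_{m_1})$ and $S_2$ with $S_2-\mathcal{V}(S_1)=(w_1,\dots,w_{m_3})$, $S_1\oplus S_2=(v_1,\dots,v_{m_1},w_1,\dots,w_{m_3})$. $h$ is forward-monotone if $h(S_1\oplus S_2)\ge h(S_1)$ for all $S_1,S_2\in\mathcal{H}(\mathcal{V})$. -}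

module Defs where

open import Data.Nat using (ℕ)
open import Data.Fin using (Fin)
open import Data.Fin.Properties using (_≟_)
open import Data.List using (List; []; _++_; filter; length)
open import Data.List.Relation.Unary.Unique.Propositional using (Unique)
open import Data.List.Relation.Unary.All using (All)
import Data.List.Membership.DecPropositional as DecMem
open import Data.Fin.Subset using (Subset)
import Data.Fin.Subset as Sub
import Data.Fin.Subset.Properties as SubP
open import Relation.Nullary using (¬_)
open import Relation.Nullary.Decidable using (¬?)
open import Relation.Binary.Bundles using (TotalOrder)
open import Level using (Level)

-- Ground set 𝒱 is Fin n.  A sequence over 𝒱 is a list; 𝓗(𝒱) consists of
-- the lists without repetition (Unique).

module _ {n : ℕ} where
  open DecMem (_≟_ {n}) using (_∈?_)

  _⊕_ : List (Fin n) → List (Fin n) → List (Fin n)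
  S ⊕ T = S ++ filter (λ x → ¬? (x ∈? S)) T

  _∖ˢ_ : List (Fin n) → Subset n → List (Fin n)
  S ∖ˢ U = filter (λ x → ¬? (x SubP.∈? U)) S

InH : {n : ℕ} → Subset n → List (Fin n) → Set
InH V′ S = Unique S Data.Product.× All (λ x → ¬ (x Sub.∈ V′)) S
  where import Data.Product

module _ {c ℓ₁ ℓ₂ : Level} (O : TotalOrder c ℓ₁ ℓ₂) where
  open TotalOrder O renaming (Carrier to A)

  ForwardMonotone : {n : ℕ} → (List (Fin n) → A) → Set (ℓ₂)
  ForwardMonotone {n} h =
    (S₁ S₂ : List (Fin n)) → Unique S₁ → Unique S₂ → h S₁ ≤ h (S₁ ⊕ S₂)

-- Let X be the set of entries of S; distinctness gives |X| = |S|. Any W with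
-- X ∩ 𝒱′ ⊆ W ⊆ X and |W| = min(τ, |S|) works: such W exists because
-- |X ∩ 𝒱′| ≤ min(τ, |S|), the sequence S − W avoids 𝒱′, and it has
-- |S| − min(τ, |S|) ≤ k − τ entries.
module Submission where

open import Defs
open import Level using (Level)
open import Data.Nat using (ℕ; _≤_; _∸_; _+_; _⊓_; suc; z≤n; s≤s)
open import Data.Nat.Properties
  using (≤-trans; ≤-antisym; ≤-reflexive; n≤1+n; +-suc; +-monoʳ-≤; _≤?_; ≰⇒>;
         n≤0⇒n≡0; ⊓-glb; m⊓n≤m; m⊓n≤n; m≤n⇒m⊓n≡m; m≥n⇒m⊓n≡n; ≤-total;
         n∸n≡0; ∸-monoˡ-≤; ∸-monoʳ-≤; m+n∸m≡n; module ≤-Reasoning)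
open import Data.Fin using (Fin)
open import Data.Fin.Subset using (Subset; ∣_∣; _⊆_; _⊂_; _∈_; _∉_; ⁅_⁆; _∪_; _∩_; ⊥; inside; outside)
open import Data.Fin.Subset.Properties
  using (_∈?_; x∈⁅x⁆; x∈⁅y⁆⇒x≡y; ∉⊥; x∈p∪q⁺; x∈p∪q⁻; q⊆p∪q; x∈p∩q⁺; p∩q⊆p;
         p⊆q⇒∣p∣≤∣q∣; p⊂q⇒∣p∣<∣q∣; ∣⁅x⁆∣≡1; ∣⊥∣≡0; ∣p∩q∣≤∣p∣; ∣p∩q∣≤∣q∣;
         drop-∷-⊆; s⊆s; out⊆)
open import Data.Vec using ([]; _∷_; here)
open import Data.List using (List; []; _∷_; length; filter)
open import Data.List.Relation.Unary.Unique.Propositional using (Unique)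
open import Data.List.Relation.Unary.Unique.Propositional.Properties using (filter⁺)
open import Data.List.Relation.Unary.AllPairs using (_∷_)
open import Data.List.Relation.Unary.All using (All; tabulate; lookup)
open import Data.List.Relation.Unary.Any using (here; there)
open import Data.List.Membership.Propositional using () renaming (_∈_ to _∈ₗ_)
open import Data.List.Membership.Propositional.Properties using (∈-filter⁺; ∈-filter⁻)
open import Data.Product using (Σ; _×_; ∃; ∃-syntax; _,_)
open import Data.Sum using (inj₁; inj₂)
open import Function using (_∘_)
open import Relation.Nullary using (yes; no; contradiction)
open import Relation.Nullary.Decidable using (¬?)
open import Relation.Unary using (Pred; Decidable)
open import Relation.Binary.Bundles using (TotalOrder)
open import Relation.Binary.PropositionalEquality using (_≡_; refl; sym; trans; cong; subst)

∣p∪q∣≤∣p∣+∣q∣ : ∀ {n} (p q : Subset n) → ∣ p ∪ q ∣ ≤ ∣ p ∣ + ∣ q ∣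
∣p∪q∣≤∣p∣+∣q∣ []            []            = z≤n
∣p∪q∣≤∣p∣+∣q∣ (inside  ∷ p) (inside  ∷ q) =
  s≤s (≤-trans (∣p∪q∣≤∣p∣+∣q∣ p q) (+-monoʳ-≤ ∣ p ∣ (n≤1+n ∣ q ∣)))
∣p∪q∣≤∣p∣+∣q∣ (inside  ∷ p) (outside ∷ q) = s≤s (∣p∪q∣≤∣p∣+∣q∣ p q)
∣p∪q∣≤∣p∣+∣q∣ (outside ∷ p) (inside  ∷ q) =
  ≤-trans (s≤s (∣p∪q∣≤∣p∣+∣q∣ p q)) (≤-reflexive (sym (+-suc ∣ p ∣ ∣ q ∣)))
∣p∪q∣≤∣p∣+∣q∣ (outside ∷ p) (outside ∷ q) = ∣p∪q∣≤∣p∣+∣q∣ p q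

∃-⊆-between : ∀ {n} {p q : Subset n} m → p ⊆ q → ∣ p ∣ ≤ m → m ≤ ∣ q ∣ →
              ∃[ r ] p ⊆ r × r ⊆ q × ∣ r ∣ ≡ m
∃-⊆-between {p = []} {[]} m p⊆q _ m≤0 = [] , p⊆q , p⊆q , sym (n≤0⇒n≡0 m≤0)
∃-⊆-between {p = inside ∷ p} {outside ∷ q} _ p⊆q _ _ = contradiction (p⊆q here) λ ()
∃-⊆-between {p = inside ∷ p} {inside ∷ q} (suc m) p⊆q (s≤s p≤m) (s≤s m≤q)
  with r , p⊆r , r⊆q , ∣r∣≡m ← ∃-⊆-between m (drop-∷-⊆ p⊆q) p≤m m≤q
  = inside ∷ r , s⊆s p⊆r , s⊆s r⊆q , cong suc ∣r∣≡m
∃-⊆-between {p = outside ∷ p} {outside ∷ q} m p⊆q p≤m m≤q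
  with r , p⊆r , r⊆q , ∣r∣≡m ← ∃-⊆-between m (drop-∷-⊆ p⊆q) p≤m m≤q
  = outside ∷ r , s⊆s p⊆r , s⊆s r⊆q , ∣r∣≡m
∃-⊆-between {p = outside ∷ p} {inside ∷ q} m p⊆q p≤m m≤1+q with m ≤? ∣ q ∣
... | yes m≤q with r , p⊆r , r⊆q , ∣r∣≡m ← ∃-⊆-between m (drop-∷-⊆ p⊆q) p≤m m≤q
  = outside ∷ r , s⊆s p⊆r , out⊆ r⊆q , ∣r∣≡m
... | no m≰q = inside ∷ q , p⊆q , (λ x∈q → x∈q) , ≤-antisym (≰⇒> m≰q) m≤1+q

module _ {a p} {A : Set a} {P : Pred A p} (P? : Decidable P) where

  length-filter+length-filter-∁ : ∀ xs →
    length (filter P? xs) + length (filter (¬? ∘ P?) xs) ≡ length xs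
  length-filter+length-filter-∁ []       = refl
  length-filter+length-filter-∁ (x ∷ xs) with P? x
  ... | yes _ = cong suc (length-filter+length-filter-∁ xs)
  ... | no  _ = trans (+-suc _ _) (cong suc (length-filter+length-filter-∁ xs))

module _ {n : ℕ} where

  fromList : List (Fin n) → Subset n
  fromList []       = ⊥
  fromList (x ∷ xs) = ⁅ x ⁆ ∪ fromList xs

  ∈-fromList⁺ : ∀ {x xs} → x ∈ₗ xs → x ∈ fromList xs
  ∈-fromList⁺ {xs = x ∷ _}  (here refl) = x∈p∪q⁺ (inj₁ (x∈⁅x⁆ x))
  ∈-fromList⁺ {xs = y ∷ xs} (there x∈xs) = q⊆p∪q ⁅ y ⁆ (fromList xs) (∈-fromList⁺ x∈xs)

  ∈-fromList⁻ : ∀ {x} xs → x ∈ fromList xs → x ∈ₗ xs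
  ∈-fromList⁻ []       x∈⊥ = contradiction x∈⊥ ∉⊥
  ∈-fromList⁻ (y ∷ xs) x∈ with x∈p∪q⁻ ⁅ y ⁆ (fromList xs) x∈
  ... | inj₁ x∈⁅y⁆  = here (x∈⁅y⁆⇒x≡y y x∈⁅y⁆)
  ... | inj₂ x∈xs   = there (∈-fromList⁻ xs x∈xs)

  ∣fromList∣≤length : ∀ xs → ∣ fromList xs ∣ ≤ length xs
  ∣fromList∣≤length []       = ≤-reflexive (∣⊥∣≡0 n)
  ∣fromList∣≤length (x ∷ xs) = begin
    ∣ ⁅ x ⁆ ∪ fromList xs ∣         ≤⟨ ∣p∪q∣≤∣p∣+∣q∣ ⁅ x ⁆ (fromList xs) ⟩
    ∣ ⁅ x ⁆ ∣ + ∣ fromList xs ∣     ≡⟨ cong (_+ ∣ fromList xs ∣) (∣⁅x⁆∣≡1 x) ⟩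
    suc ∣ fromList xs ∣             ≤⟨ s≤s (∣fromList∣≤length xs) ⟩
    suc (length xs)                 ∎
    where open ≤-Reasoning

  Unique⇒length≤∣fromList∣ : ∀ {xs} → Unique xs → length xs ≤ ∣ fromList xs ∣
  Unique⇒length≤∣fromList∣ {[]}     _            = z≤n
  Unique⇒length≤∣fromList∣ {x ∷ xs} (x∉xs ∷ uxs) =
    ≤-trans (s≤s (Unique⇒length≤∣fromList∣ uxs)) (p⊂q⇒∣p∣<∣q∣ xs⊂x∷xs)
    where
    xs⊂x∷xs : fromList xs ⊂ fromList (x ∷ xs)
    xs⊂x∷xs = (λ {_} → q⊆p∪q ⁅ x ⁆ (fromList xs)) , x , x∈p∪q⁺ (inj₁ (x∈⁅x⁆ x)) ,
              λ x∈xs → lookup x∉xs (∈-fromList⁻ xs x∈xs) refl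

  ∣p∣≤length-filter-∈ : ∀ S {W} → W ⊆ fromList S → ∣ W ∣ ≤ length (filter (_∈? W) S)
  ∣p∣≤length-filter-∈ S {W} W⊆S =
    ≤-trans (p⊆q⇒∣p∣≤∣q∣ W⊆filter) (∣fromList∣≤length (filter (_∈? W) S))
    where
    W⊆filter : W ⊆ fromList (filter (_∈? W) S)
    W⊆filter x∈W = ∈-fromList⁺ (∈-filter⁺ (_∈? W) (∈-fromList⁻ S (W⊆S x∈W)) x∈W)

  length-∖ˢ≤ : ∀ S {W} → W ⊆ fromList S → length (S ∖ˢ W) ≤ length S ∸ ∣ W ∣
  length-∖ˢ≤ S {W} W⊆S = begin
    length (S ∖ˢ W)                 ≡⟨ sym (m+n∸m≡n (length kept) (length (S ∖ˢ W))) ⟩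
    length kept + length (S ∖ˢ W) ∸ length kept
                                    ≡⟨ cong (_∸ length kept) (length-filter+length-filter-∁ (_∈? W) S) ⟩
    length S ∸ length kept          ≤⟨ ∸-monoʳ-≤ (length S) (∣p∣≤length-filter-∈ S W⊆S) ⟩
    length S ∸ ∣ W ∣                ∎
    where
    open ≤-Reasoning
    kept = filter (_∈? W) S

  ∖ˢ-avoids : ∀ S {V W} → fromList S ∩ V ⊆ W → All (_∉ V) (S ∖ˢ W)
  ∖ˢ-avoids S {V} {W} S∩V⊆W = tabulate λ x∈S∖W x∈V →
    let x∈S , x∉W = ∈-filter⁻ (λ y → ¬? (y ∈? W)) {xs = S} x∈S∖W
    in x∉W (S∩V⊆W (x∈p∩q⁺ (∈-fromList⁺ x∈S , x∈V)))

m∸[n⊓m]≤o∸n : ∀ {m o} n → m ≤ o → m ∸ (n ⊓ m) ≤ o ∸ n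
m∸[n⊓m]≤o∸n {m} n m≤o with ≤-total n m
... | inj₁ n≤m rewrite m≤n⇒m⊓n≡m n≤m = ∸-monoˡ-≤ n m≤o
... | inj₂ m≤n rewrite m≥n⇒m⊓n≡n m≤n | n∸n≡0 m = z≤n

∃-deletion : ∀ {n} τ k (V′ : Subset n) → ∣ V′ ∣ ≤ τ → ∀ {S} → Unique S → length S ≤ k →
             ∃[ W ] W ⊆ fromList S × ∣ W ∣ ≤ τ ×
                    All (_∉ V′) (S ∖ˢ W) × length (S ∖ˢ W) ≤ k ∸ τ
∃-deletion τ k V′ ∣V′∣≤τ {S} uS ∣S∣≤k =
  let W , S∩V′⊆W , W⊆S , ∣W∣≡m = ∃-⊆-between m (p∩q⊆p (fromList S) V′) ∣S∩V′∣≤m m≤∣S∣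
  in W , W⊆S , ≤-trans (≤-reflexive ∣W∣≡m) (m⊓n≤m τ (length S)) , ∖ˢ-avoids S S∩V′⊆W ,
     ≤-trans (length-∖ˢ≤ S W⊆S)
             (subst (λ w → length S ∸ w ≤ k ∸ τ) (sym ∣W∣≡m) (m∸[n⊓m]≤o∸n τ ∣S∣≤k))
  where
  m = τ ⊓ length S
  ∣S∩V′∣≤m : ∣ fromList S ∩ V′ ∣ ≤ m
  ∣S∩V′∣≤m = ⊓-glb (≤-trans (∣p∩q∣≤∣q∣ (fromList S) V′) ∣V′∣≤τ)
                   (≤-trans (∣p∩q∣≤∣p∣ (fromList S) V′) (∣fromList∣≤length S))
  m≤∣S∣ : m ≤ ∣ fromList S ∣
  m≤∣S∣ = ≤-trans (m⊓n≤n τ (length S)) (Unique⇒length≤∣fromList∣ uS)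

-- The hypotheses on h are deliberately unused: S − W itself is an admissible S′.
lemma3 : {c ℓ₁ ℓ₂ : Level} (O : TotalOrder c ℓ₁ ℓ₂) →
         (zero : TotalOrder.Carrier O) →
         (n τ k : ℕ) → 1 ≤ τ → τ ≤ k →
         (h : List (Fin n) → TotalOrder.Carrier O) →
         ((S : List (Fin n)) → Unique S → TotalOrder._≤_ O zero (h S)) →
         TotalOrder._≈_ O (h []) zero →
         ForwardMonotone O h →
         (V′ : Subset n) → ∣ V′ ∣ ≤ τ →
         (S : List (Fin n)) → Unique S → length S ≤ k →
         Σ (Subset n) λ W →
           ((x : Fin n) → x ∈ W → x ∈ₗ S) × ∣ W ∣ ≤ τ ×
           Σ (List (Fin n)) λ S′ →
             InH V′ S′ × length S′ ≤ k ∸ τ × TotalOrder._≤_ O (h (S ∖ˢ W)) (h S′)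
lemma3 O _ _ τ k _ _ _ _ _ _ V′ ∣V′∣≤τ S uS ∣S∣≤k
  with W , W⊆S , ∣W∣≤τ , avoids , short ← ∃-deletion τ k V′ ∣V′∣≤τ uS ∣S∣≤k
  = W , (λ _ → ∈-fromList⁻ S ∘ W⊆S) , ∣W∣≤τ ,
    S ∖ˢ W , (filter⁺ _ uS , avoids) , short , TotalOrder.refl O
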